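{- Let $\Sigma$ be a finite alphabet and let $p,q$ be words on $\Sigma$ with the same set of border lengths (in particular $|p|=|q|$). Let $n\in\mathbb{N}$, $w \in A_n(p)$ and $v \in A_n(q)$. Then $$\phi_R(v) = \overline{\overline{\phi_L}(\overline{v})} \quad\text{and}\quad \phi_L(w) = \overline{\overline{\phi_R}(\overline{w})}.$$
   Context: $A_n(p)$ is the set of words of length $n$ on $\Sigma$ not containing $p$ as a contiguous factor. A non-empty word $x$ is a border of $p$ if it is both a prefix and a suffix of $p$; the border length set of $p$ is $\{|x| : x \text{ a border of } p\}$. For a word $u$, $\overline{u}$ denotes its reversal. Define the following single-step maps on words: $L$ replaces the leftmost occurrence of $q$ with $p$; $R$ replaces the rightmost occurrence of $p$ with $q$; $\overline{L}$ replaces the leftmost occurrence of $\overline{p}$ with $\overline{q}$; $\overline{R}$ replaces the rightmost occurrence of $\overline{q}$ with $\overline{p}$; each acts as the identity if the relevant pattern does not occur. Then: for $w\in A_n(p)$, $\phi_L(w)=L^i(w)$ with $i$ least such that $L^i(w)$ contains no $q$; for $v \in A_n(q)$, $\phi_R(v)=R^j(v)$ with $j$ least such that $R^j(v)$ contains no $p$; for $u\in A_n(\overline{q})$, $\overline{\phi_L}(u)=\overline{L}^i(u)$ with $i$ least such that $\overline{L}^i(u)$ contains no $\overline{p}$; for $u\in A_n(\overline{p})$, $\overline{\phi_R}(u)=\overline{R}^j(u)$ with $j$ least such that $\overline{R}^j(u)$ contains no $\overline{q}$. (These iterations always terminate.) -}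

module Defs where

open import Data.Nat using (ℕ; zero; suc; _<_)
open import Data.Fin using (Fin)
open import Data.Fin.Properties using (_≟_)
open import Data.List using (List; []; _∷_; _++_; length; drop; reverse)
open import Data.List.Properties using (≡-dec)
open import Data.Bool using (Bool; true; false; if_then_else_)
open import Data.Product using (Σ; ∃; _×_)
open import Relation.Nullary using (¬_; Dec; yes; no; does)
open import Relation.Binary.PropositionalEquality using (_≡_)

Word : ℕ → Set
Word k = List (Fin k)

prefix? : ∀ {k} → Word k → Word k → Bool
prefix? [] w = true
prefix? (a ∷ pat) [] = false
prefix? (a ∷ pat) (b ∷ w) = if does (a ≟ b) then prefix? pat w else false

occurs? : ∀ {k} → Word k → Word k → Bool
occurs? pat [] = prefix? pat []
occurs? pat (b ∷ w) = if prefix? pat (b ∷ w) then true else occurs? pat w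

replaceLeftmost : ∀ {k} → Word k → Word k → Word k → Word k
replaceLeftmost pat rep [] = if prefix? pat [] then rep else []
replaceLeftmost pat rep (b ∷ w) =
  if prefix? pat (b ∷ w) then rep ++ drop (length pat) (b ∷ w)
  else b ∷ replaceLeftmost pat rep w

replaceRightmost : ∀ {k} → Word k → Word k → Word k → Word k
replaceRightmost pat rep [] = if prefix? pat [] then rep else []
replaceRightmost pat rep (b ∷ w) =
  if occurs? pat w then b ∷ replaceRightmost pat rep w
  else (if prefix? pat (b ∷ w) then rep ++ drop (length pat) (b ∷ w) else b ∷ w)

Factor : ∀ {k} → Word k → Word k → Set
Factor u w = ∃ λ a → ∃ λ b → a ++ u ++ b ≡ w

InA : ∀ {k} → ℕ → Word k → Word k → Set
InA n p w = (length w ≡ n) × ¬ Factor p w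

Border : ∀ {k} → Word k → Word k → Set
Border x p = ¬ (x ≡ []) × (∃ λ y → x ++ y ≡ p) × (∃ λ y → y ++ x ≡ p)

IsBorderLength : ∀ {k} → Word k → ℕ → Set
IsBorderLength p m = ∃ λ x → Border x p × length x ≡ m

SameBorderLengths : ∀ {k} → Word k → Word k → Set
SameBorderLengths p q =
  ∀ m → (IsBorderLength p m → IsBorderLength q m) × (IsBorderLength q m → IsBorderLength p m)

iter : ∀ {A : Set} → (A → A) → ℕ → A → A
iter f zero x = x
iter f (suc j) x = f (iter f j x)

LeastStop : ∀ {k} → (Word k → Word k) → Word k → Word k → ℕ → Set
LeastStop f pat x j = ¬ Factor pat (iter f j x) × (∀ m → m < j → Factor pat (iter f m x))

stepL stepR stepLbar stepRbar : ∀ {k} → Word k → Word k → Word k → Word k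
stepL p q = replaceLeftmost q p
stepR p q = replaceRightmost p q
stepLbar p q = replaceLeftmost (reverse p) (reverse q)
stepRbar p q = replaceRightmost (reverse q) (reverse p)

-- Reversal turns the rightmost occurrence of a pattern in a word into the leftmost occurrence
-- of the reversed pattern in the reversed word, so one step of R is conjugate under reversal to
-- one step of L̄, and likewise L to R̄. The iterations are then conjugate step by step,
-- they stop at the same index, and their results are reverses of each other.

module Submission where

open import Defs
open import Data.Nat using (ℕ; zero; suc; _+_; _≤_; _<_; z≤n; s≤s; s≤s⁻¹)
open import Data.Nat.Properties using (+-cancelˡ-≤; +-monoˡ-≤; <-cmp)
open import Data.List using ([]; _∷_; _++_; length; drop; reverse)
open import Data.List.Properties
  using (reverse-++; reverse-involutive; length-reverse; length-++; ++-assoc; ++-identityʳ;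
         ++-conicalˡ; ∷-injective)
open import Data.Bool using (true; false; if_then_else_)
open import Data.Product using (_×_; _,_; ∃; ∃₂; proj₂)
open import Function using (_∘_)
open import Function.Bundles using (_⇔_; mk⇔; Equivalence)
open import Relation.Nullary using (¬_; Dec; yes; no; contradiction)
open import Relation.Binary.PropositionalEquality
  using (_≡_; refl; sym; trans; cong; cong₂; subst; subst₂; module ≡-Reasoning)
open import Relation.Binary.Definitions using (tri<; tri≈; tri>)
open import Data.Fin.Properties using (_≟_)

private
  variable
    k i j : ℕ
    pat rep a b x y w : Word k

prefix?-sound : prefix? pat w ≡ true → ∃ λ b → pat ++ b ≡ w
prefix?-sound {pat = []} {w = w} _ = w , refl
prefix?-sound {pat = e ∷ pat} {w = f ∷ w} eq with e ≟ f
... | yes refl = let (b , eq′) = prefix?-sound {pat = pat} {w = w} eq in b , cong (e ∷_) eq′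

prefix?-++ : (pat b : Word k) → prefix? pat (pat ++ b) ≡ true
prefix?-++ [] b = refl
prefix?-++ (e ∷ pat) b with e ≟ e
... | yes _ = prefix?-++ pat b
... | no e≢e = contradiction refl e≢e

Factor-∷ : ∀ e → Factor pat w → Factor pat (e ∷ w)
Factor-∷ e (a , b , eq) = e ∷ a , b , cong (e ∷_) eq

occurs?-sound : occurs? pat w ≡ true → Factor pat w
occurs?-sound {w = []} eq = [] , prefix?-sound eq
occurs?-sound {pat = pat} {w = e ∷ w} eq with prefix? pat (e ∷ w) in isPrefix
... | true = [] , prefix?-sound isPrefix
... | false = Factor-∷ e (occurs?-sound eq)

prefix?⇒occurs? : prefix? pat w ≡ true → occurs? pat w ≡ true
prefix?⇒occurs? {w = []} isPrefix = isPrefix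
prefix?⇒occurs? {w = _ ∷ _} isPrefix rewrite isPrefix = refl

occurs?-++ : (a pat b : Word k) → occurs? pat (a ++ pat ++ b) ≡ true
occurs?-++ [] pat b = prefix?⇒occurs? {pat = pat} {w = pat ++ b} (prefix?-++ pat b)
occurs?-++ (e ∷ a) pat b with prefix? pat (e ∷ a ++ pat ++ b)
... | true = refl
... | false = occurs?-++ a pat b

occurs?-complete : Factor pat w → occurs? pat w ≡ true
occurs?-complete (a , b , refl) = occurs?-++ a _ b

occurs?-absent : ¬ Factor pat w → occurs? pat w ≡ false
occurs?-absent {pat = pat} {w = w} ¬factor with occurs? pat w in occurs
... | true = contradiction (occurs?-sound occurs) ¬factor
... | false = refl

Factor? : (pat w : Word k) → Dec (Factor pat w)
Factor? pat w with occurs? pat w in occurs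
... | true = yes (occurs?-sound occurs)
... | false = no λ factor → contradiction (trans (sym (occurs?-complete factor)) occurs) λ ()

reverse-split : (a pat b : Word k) → a ++ pat ++ b ≡ w →
  reverse b ++ reverse pat ++ reverse a ≡ reverse w
reverse-split a pat b refl = begin
  reverse b ++ reverse pat ++ reverse a   ≡⟨ ++-assoc (reverse b) (reverse pat) (reverse a) ⟨
  (reverse b ++ reverse pat) ++ reverse a ≡⟨ cong (_++ reverse a) (reverse-++ pat b) ⟨
  reverse (pat ++ b) ++ reverse a         ≡⟨ reverse-++ a (pat ++ b) ⟨
  reverse (a ++ pat ++ b)                 ∎
  where open ≡-Reasoning

unreverse-split : (a pat b : Word k) → a ++ reverse pat ++ b ≡ reverse w →
  reverse b ++ pat ++ reverse a ≡ w
unreverse-split {w = w} a pat b eq =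
  subst₂ (λ p v → reverse b ++ p ++ reverse a ≡ v)
         (reverse-involutive pat) (reverse-involutive w) (reverse-split a (reverse pat) b eq)

Factor-reverse : Factor pat w ⇔ Factor (reverse pat) (reverse w)
Factor-reverse = mk⇔ (λ (a , b , eq) → reverse b , reverse a , reverse-split a _ b eq)
                     (λ (a , b , eq) → reverse b , reverse a , unreverse-split a _ b eq)

length-split : (a pat b : Word k) → a ++ pat ++ b ≡ w →
  length a + (length pat + length b) ≡ length w
length-split a pat b refl = sym (trans (length-++ a) (cong (length a +_) (length-++ pat)))

RightmostOccurrence LeftmostOccurrence : Word k → Word k → Word k → Word k → Set
RightmostOccurrence pat x a b =
  a ++ pat ++ b ≡ x × (∀ a′ b′ → a′ ++ pat ++ b′ ≡ x → length a′ ≤ length a)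
LeftmostOccurrence pat x a b =
  a ++ pat ++ b ≡ x × (∀ a′ b′ → a′ ++ pat ++ b′ ≡ x → length a ≤ length a′)

rightmostOccurrence : Factor pat x → ∃₂ (RightmostOccurrence pat x)
rightmostOccurrence {x = []} (a , b , eq) = a , b , eq , λ a′ _ eq′ →
  subst (λ a″ → length a″ ≤ length a) (sym (++-conicalˡ a′ _ eq′)) z≤n
rightmostOccurrence {pat = pat} {x = e ∷ x} factor with Factor? pat x
... | yes inTail =
  let (a , b , eq , rightmost) = rightmostOccurrence {pat = pat} {x = x} inTail
  in e ∷ a , b , cong (e ∷_) eq , λ where
       []       _  _   → z≤n
       (_ ∷ a′) b′ eq′ → s≤s (rightmost a′ b′ (proj₂ (∷-injective eq′)))
... | no notInTail with factor
...   | (_ ∷ a , b , eq) = contradiction (a , b , proj₂ (∷-injective eq)) notInTail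
...   | ([] , b , eq) = [] , b , eq , λ where
          []       _  _   → z≤n
          (_ ∷ a′) b′ eq′ →
            contradiction (a′ , b′ , proj₂ (∷-injective eq′)) notInTail

drop-length-++ : (pat b : Word k) → drop (length pat) (pat ++ b) ≡ b
drop-length-++ [] b = refl
drop-length-++ (_ ∷ pat) b = drop-length-++ pat b

replace-in-[] : (a pat b rep : Word k) → a ++ pat ++ b ≡ [] →
  (if prefix? pat [] then rep else []) ≡ a ++ rep ++ b
replace-in-[] []      []      []      rep refl = sym (++-identityʳ rep)
replace-in-[] []      []      (_ ∷ _) rep ()
replace-in-[] []      (_ ∷ _) _       rep ()
replace-in-[] (_ ∷ _) _       _       rep ()

replace-at-prefix : (rep : Word k) → pat ++ b ≡ y →
  (if prefix? pat y then rep ++ drop (length pat) y else w) ≡ rep ++ b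
replace-at-prefix {pat = pat} {b = b} rep refl rewrite prefix?-++ pat b =
  cong (rep ++_) (drop-length-++ pat b)

replaceRightmost-at : (a b : Word k) → RightmostOccurrence pat x a b →
  replaceRightmost pat rep x ≡ a ++ rep ++ b
replaceRightmost-at {pat = pat} {x = []} {rep = rep} a b (eq , _) = replace-in-[] a pat b rep eq
replaceRightmost-at {pat = pat} {x = e ∷ x} {rep = rep} [] b (eq , rightmost)
  with occurs? pat x in occurs
... | true = let (a′ , b′ , eq′) = occurs?-sound occurs
             in contradiction (rightmost (e ∷ a′) b′ (cong (e ∷_) eq′)) λ ()
... | false = replace-at-prefix rep eq
replaceRightmost-at {pat = pat} {x = e ∷ x} (_ ∷ a) b (eq , rightmost)
  with ∷-injective eq | occurs? pat x in occurs
... | refl , eq′ | true = cong (e ∷_) (replaceRightmost-at a b (eq′ , λ a″ b″ eq″ →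
        s≤s⁻¹ (rightmost (e ∷ a″) b″ (cong (e ∷_) eq″))))
... | _ , eq′ | false =
  contradiction (trans (sym (occurs?-complete (a , b , eq′))) occurs) λ ()

replaceLeftmost-at : (a b : Word k) → LeftmostOccurrence pat y a b →
  replaceLeftmost pat rep y ≡ a ++ rep ++ b
replaceLeftmost-at {pat = pat} {y = []} {rep = rep} a b (eq , _) = replace-in-[] a pat b rep eq
replaceLeftmost-at {y = _ ∷ _} {rep = rep} [] b (eq , _) = replace-at-prefix rep eq
replaceLeftmost-at {pat = pat} {y = e ∷ y} (_ ∷ a) b (eq , leftmost)
  with ∷-injective eq | prefix? pat (e ∷ y) in isPrefix
... | _ , _ | true = let (b₀ , eq₀) = prefix?-sound {pat = pat} isPrefix
                     in contradiction (leftmost [] b₀ eq₀) λ ()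
... | refl , eq′ | false = cong (e ∷_) (replaceLeftmost-at a b (eq′ , λ a″ b″ eq″ →
        s≤s⁻¹ (leftmost (e ∷ a″) b″ (cong (e ∷_) eq″))))

replaceRightmost-absent : ¬ Factor pat x → replaceRightmost pat rep x ≡ x
replaceRightmost-absent {x = []} absent rewrite occurs?-absent absent = refl
replaceRightmost-absent {pat = pat} {x = e ∷ x} absent
  rewrite occurs?-absent {pat = pat} {w = x} (absent ∘ Factor-∷ e)
  with prefix? pat (e ∷ x) in isPrefix
... | true = contradiction ([] , prefix?-sound {pat = pat} isPrefix) absent
... | false = refl

replaceLeftmost-absent : ¬ Factor pat x → replaceLeftmost pat rep x ≡ x
replaceLeftmost-absent {x = []} absent rewrite occurs?-absent absent = refl
replaceLeftmost-absent {pat = pat} {x = e ∷ x} absent with prefix? pat (e ∷ x) in isPrefix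
... | true = contradiction ([] , prefix?-sound {pat = pat} isPrefix) absent
... | false = cong (e ∷_) (replaceLeftmost-absent (absent ∘ Factor-∷ e))

m+[n+o]≡p+[n+q]⇒p≤m⇒o≤q : ∀ {m n o p q} → m + (n + o) ≡ p + (n + q) → p ≤ m → o ≤ q
m+[n+o]≡p+[n+q]⇒p≤m⇒o≤q {m} {n} {o} {p} {q} eq p≤m =
  +-cancelˡ-≤ n o q (+-cancelˡ-≤ p (n + o) (n + q)
    (subst (p + (n + o) ≤_) eq (+-monoˡ-≤ (n + o) p≤m)))

reverse-rightmost : (a b : Word k) → RightmostOccurrence pat x a b →
  LeftmostOccurrence (reverse pat) (reverse x) (reverse b) (reverse a)
reverse-rightmost {pat = pat} {x = x} a b (eq , rightmost) = reverse-split a pat b eq , leftmost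
  where
  leftmost : ∀ a′ b′ → a′ ++ reverse pat ++ b′ ≡ reverse x → length (reverse b) ≤ length a′
  leftmost a′ b′ eq′ = subst₂ _≤_ (sym (length-reverse b)) (length-reverse a′)
    (m+[n+o]≡p+[n+q]⇒p≤m⇒o≤q
      (trans (length-split a pat b eq) (sym (length-split (reverse b′) pat (reverse a′) eq″)))
      (rightmost (reverse b′) (reverse a′) eq″))
    where eq″ = unreverse-split a′ pat b′ eq′

replaceLeftmost-reverse : (pat rep x : Word k) →
  replaceLeftmost (reverse pat) (reverse rep) (reverse x) ≡ reverse (replaceRightmost pat rep x)
replaceLeftmost-reverse pat rep x with Factor? pat x
... | no absent = trans (replaceLeftmost-absent (absent ∘ Equivalence.from Factor-reverse))
                        (cong reverse (sym (replaceRightmost-absent absent)))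
... | yes factor with rightmostOccurrence {pat = pat} {x = x} factor
...   | a , b , rightmost = begin
  replaceLeftmost (reverse pat) (reverse rep) (reverse x)
    ≡⟨ replaceLeftmost-at (reverse b) (reverse a) (reverse-rightmost a b rightmost) ⟩
  reverse b ++ reverse rep ++ reverse a ≡⟨ reverse-split a rep b refl ⟩
  reverse (a ++ rep ++ b)               ≡⟨ cong reverse (replaceRightmost-at a b rightmost) ⟨
  reverse (replaceRightmost pat rep x)  ∎
  where open ≡-Reasoning

replaceRightmost-reverse : (pat rep x : Word k) →
  replaceRightmost (reverse pat) (reverse rep) (reverse x) ≡ reverse (replaceLeftmost pat rep x)
replaceRightmost-reverse pat rep x = begin
  replaceRightmost (reverse pat) (reverse rep) (reverse x)
    ≡⟨ reverse-involutive _ ⟨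
  reverse (reverse (replaceRightmost (reverse pat) (reverse rep) (reverse x)))
    ≡⟨ cong reverse (replaceLeftmost-reverse (reverse pat) (reverse rep) (reverse x)) ⟨
  reverse (replaceLeftmost (reverse (reverse pat)) (reverse (reverse rep)) (reverse (reverse x)))
    ≡⟨ cong₂ (λ p r → reverse (replaceLeftmost p r (reverse (reverse x))))
             (reverse-involutive pat) (reverse-involutive rep) ⟩
  reverse (replaceLeftmost pat rep (reverse (reverse x)))
    ≡⟨ cong (reverse ∘ replaceLeftmost pat rep) (reverse-involutive x) ⟩
  reverse (replaceLeftmost pat rep x) ∎
  where open ≡-Reasoning

iter-conjugate : {A B : Set} {f : A → A} {g : B → B} {h : A → B} →
  (∀ z → g (h z) ≡ h (f z)) → ∀ m z → iter g m (h z) ≡ h (iter f m z)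
iter-conjugate comm zero z = refl
iter-conjugate {f = f} {g = g} comm (suc m) z =
  trans (cong g (iter-conjugate comm m z)) (comm (iter f m z))

FirstFailure : (ℕ → Set) → ℕ → Set
FirstFailure P j = ¬ P j × (∀ m → m < j → P m)

firstFailure-unique : {P Q : ℕ → Set} → (∀ m → P m ⇔ Q m) →
  FirstFailure P j → FirstFailure Q i → j ≡ i
firstFailure-unique {j = j} {i = i} P⇔Q (¬Pj , belowJ) (¬Qi , belowI) with <-cmp j i
... | tri< j<i _ _ = contradiction (Equivalence.from (P⇔Q j) (belowI j j<i)) ¬Pj
... | tri≈ _ j≡i _ = j≡i
... | tri> _ _ i<j = contradiction (Equivalence.to (P⇔Q i) (belowJ i i<j)) ¬Qi

leastStop-reverse : {f g : Word k → Word k} → (∀ z → g (reverse z) ≡ reverse (f z)) →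
  LeastStop f pat x j → LeastStop g (reverse pat) (reverse x) i →
  iter f j x ≡ reverse (iter g i (reverse x))
leastStop-reverse {pat = pat} {x = x} {j = j} {f = f} {g = g} comm stopF stopG
  with firstFailure-unique {P = λ m → Factor pat (iter f m x)} factors stopF stopG
  where
  factors : ∀ m → Factor pat (iter f m x) ⇔ Factor (reverse pat) (iter g m (reverse x))
  factors m = subst (λ v → Factor pat (iter f m x) ⇔ Factor (reverse pat) v)
                    (sym (iter-conjugate comm m x)) Factor-reverse
... | refl = sym (trans (cong reverse (iter-conjugate comm j x)) (reverse-involutive _))

lemma2 : ∀ {k} (p q : Word k) → SameBorderLengths p q →
    ∀ (n : ℕ) (w v : Word k) → InA n p w → InA n q v →
    (∀ (j i : ℕ) →
      LeastStop (stepR p q) p v j →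
      LeastStop (stepLbar p q) (reverse p) (reverse v) i →
      iter (stepR p q) j v ≡ reverse (iter (stepLbar p q) i (reverse v)))
    ×
    (∀ (i j : ℕ) →
      LeastStop (stepL p q) q w i →
      LeastStop (stepRbar p q) (reverse q) (reverse w) j →
      iter (stepL p q) i w ≡ reverse (iter (stepRbar p q) j (reverse w)))
lemma2 p q _ _ _ _ _ _ =
  (λ _ _ → leastStop-reverse (replaceLeftmost-reverse p q)) ,
  (λ _ _ → leastStop-reverse (replaceRightmost-reverse q p))
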